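{- Let $p$ be a prime and let $q\in\mathbb{C}_p$ with $q\neq 1$ and $|q-1|_p<p^{ -1/(p-1)}$. For $n\in\mathbb{N}$ and $m\in\mathbb{Z}_{+}=\{0,1,2,\dots\}$, $$\binom{n}{m} = \sum_{k=m}^{n} (q-1)^{k-m} \begin{bmatrix} n \\ k\end{bmatrix}_{q} s_{1, q}(k, m),$$ where $s_{1,q}(k,m)$ are the $q$-Stirling numbers of the first kind.
   Context: $\mathbb{C}_p$ is the completion of an algebraic closure of $\mathbb{Q}_p$. Set $[x]_q=\frac{1-q^x}{1-q}$, $[n]_q!=\prod_{i=1}^n[i]_q$, and $\begin{bmatrix} n\\k\end{bmatrix}_q=\frac{[n]_q!}{[k]_q![n-k]_q!}$. Let $[x]_{k,q}=[x]_q[x-1]_q\cdots[x-k+1]_q$ (with $[x]_{0,q}=1$). The $q$-Stirling numbers of the first kind $s_{1,q}(k,l)$, $0\le l\le k$, are the numbers (independent of $x$) such that $[x]_{k,q}=q^{ -\binom{k}{2}}\sum_{l=0}^{k}s_{1,q}(k,l)[x]_q^l$ for all $x$. -}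

module Defs where

open import Level using (Level)
open import Data.Nat as ℕ using (ℕ; zero; suc; _∸_)
open import Data.Nat.Combinatorics using (_C_)
open import Data.Sum using (_⊎_)
open import Relation.Nullary using (¬_)
open import Algebra.Bundles using (CommutativeRing)

module _ {c ℓ : Level} (R : CommutativeRing c ℓ) where
  open CommutativeRing R

  pow : Carrier → ℕ → Carrier
  pow a zero    = 1#
  pow a (suc n) = a * pow a n

  nat : ℕ → Carrier
  nat zero    = 0#
  nat (suc n) = 1# + nat n

  -- Σ_{k=a}^{b} f k   (empty, i.e. 0, when a > b)
  sumFromTo : ℕ → ℕ → (ℕ → Carrier) → Carrier
  sumFromTo a b f = go (suc b ∸ a)
    where
    go : ℕ → Carrier
    go zero    = 0#
    go (suc i) = f (a ℕ.+ i) + go i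

  sumTo : ℕ → (ℕ → Carrier) → Carrier
  sumTo k f = sumFromTo 0 k f

  IsDomain : Set (c Level.⊔ ℓ)
  IsDomain = (¬ (1# ≈ 0#)) × (∀ a b → a * b ≈ 0# → (a ≈ 0#) ⊎ (b ≈ 0#))
    where open import Data.Product using (_×_)

  -- q-number for natural x:  [x]_q = (1 - q^x)/(1 - q) = 1 + q + ... + q^(x-1)
  -- (the division is exact; we use the quotient polynomial directly,
  --  which is the unique solution of (1 - q)·[x]_q = 1 - q^x when q ≠ 1 in a domain)
  qnum : Carrier → ℕ → Carrier
  qnum q zero    = 0#
  qnum q (suc x) = 1# + q * qnum q x

  qfact : Carrier → ℕ → Carrier
  qfact q zero    = 1#
  qfact q (suc n) = qnum q (suc n) * qfact q n

  -- falling q-factorial  [x]_{k,q} = [x]_q [x-1]_q ... [x-k+1]_q  (used for x ≥ k)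
  qfall : Carrier → ℕ → ℕ → Carrier
  qfall q x zero    = 1#
  qfall q x (suc k) = qfall q x k * qnum q (x ∸ k)

  NotRootOfUnity : Carrier → Set ℓ
  NotRootOfUnity q = ∀ j → ¬ (pow q (suc j) ≈ 1#)

  -- G is the Gaussian binomial coefficient [n k]_q = [n]_q! / ([k]_q! [n-k]_q!)
  -- (for k ≤ n; characterised by the defining equation, unique in a domain
  --  where q is not a root of unity)
  IsGaussBinom : Carrier → (ℕ → ℕ → Carrier) → Set ℓ
  IsGaussBinom q G = ∀ n k → k ℕ.≤ n →
    (qfact q k * qfact q (n ∸ k)) * G n k ≈ qfact q n

  -- s is the q-Stirling numbers of the first kind:
  --   [x]_{k,q} = q^{-C(k,2)} Σ_{l=0}^{k} s(k,l) [x]_q^l,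
  -- written multiplied through by q^{C(k,2)}, required for all natural x ≥ k
  IsQStirling1 : Carrier → (ℕ → ℕ → Carrier) → Set ℓ
  IsQStirling1 q s = ∀ k x → k ℕ.≤ x →
    pow q (k C 2) * qfall q x k ≈ sumTo k (λ l → s k l * pow (qnum q x) l)

{-# OPTIONS --safe #-}
-- Put δ = q - 1 and t = [x]_q, so that q^x = 1 + δ t.  For x ≥ n expand
-- (q^x)^n in two ways: by the binomial theorem it is Σ_l C(n,l) δ^l t^l,
-- and by the q-binomial theorem it is Σ_k [n k]_q δ^k q^C(k,2) [x]_{k,q},
-- which after inserting the q-Stirling expansion of q^C(k,2) [x]_{k,q}
-- becomes Σ_l (Σ_k [n k]_q δ^k s_{1,q}(k,l)) t^l.  Both are polynomials in t
-- of degree at most n agreeing at the infinitely many distinct values [x]_q,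
-- so their coefficients agree; the coefficient of t^m, divided by δ^m, is
-- the identity.
module Submission where

open import Defs
open import Level using (Level)
open import Data.Nat using (ℕ; _∸_)
open import Data.Nat.Combinatorics using (_C_)
open import Relation.Nullary using (¬_)
open import Algebra.Bundles using (CommutativeRing)

open import Data.Nat.Base as ℕ using (zero; suc; _≤_; _<_; z≤n; s≤s)
import Data.Nat.Properties as ℕ
open import Data.Nat.Combinatorics using (nCn≡1; nC1≡n; nCk+nC[k+1]≡[n+1]C[k+1])
open import Data.Nat.Combinatorics.Specification using (k>n⇒nCk≡0)
open import Data.Fin.Base using (Fin; toℕ)
open import Data.Fin.Properties using (toℕ<n; toℕ-inject₁; toℕ-fromℕ)
open import Data.Product.Base using (proj₁; proj₂)
open import Data.Sum.Base using (inj₁; inj₂)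
open import Data.Empty using (⊥-elim)
open import Relation.Nullary using (yes; no)
open import Relation.Binary.PropositionalEquality as P using (_≡_)

module _ {r ℓ : Level} (R : CommutativeRing r ℓ) where
  open CommutativeRing R hiding (zero)
  open import Algebra.Properties.Ring ring using (-1*x≈-x; x[y-z]≈xy-xz; [y-z]x≈yx-zx; +-cancelˡ)
  open import Algebra.Properties.AbelianGroup +-abelianGroup using (x∙y⁻¹≈ε⇒x≈y; x≈y⇒x∙y⁻¹≈ε)
  open import Algebra.Properties.CommutativeSemigroup *-commutativeSemigroup using (x∙yz≈y∙xz)
  open import Algebra.Properties.Semiring.Sum semiring using (sum; sum-cong-≋; sum-replicate-zero; sum-init-last)
  import Algebra.Properties.Semiring.Sum semiring as Sum
  open import Algebra.Properties.Monoid.Mult +-monoid using (_×_; ×-homo-+)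
  import Algebra.Properties.CommutativeSemiring.Exp commutativeSemiring as Exp
  open import Algebra.Solver.Ring.NaturalCoefficients.Default commutativeSemiring
  open import Relation.Binary.Reasoning.Setoid setoid

  infixr 8 _^_
  _^_ : Carrier → ℕ → Carrier
  _^_ = pow R

  ^≡Exp^ : ∀ a n → a ^ n ≡ a Exp.^ n
  ^≡Exp^ a zero    = P.refl
  ^≡Exp^ a (suc n) = P.cong (a *_) (^≡Exp^ a n)

  ^-congˡ : ∀ {a b} n → a ≈ b → a ^ n ≈ b ^ n
  ^-congˡ {a} {b} n a≈b rewrite ^≡Exp^ a n | ^≡Exp^ b n = Exp.^-congˡ n a≈b

  ^-homo-* : ∀ a m n → a ^ (m ℕ.+ n) ≈ a ^ m * a ^ n
  ^-homo-* a m n rewrite ^≡Exp^ a (m ℕ.+ n) | ^≡Exp^ a m | ^≡Exp^ a n = Exp.^-homo-* a m n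

  ^-distrib-* : ∀ a b n → (a * b) ^ n ≈ a ^ n * b ^ n
  ^-distrib-* a b n rewrite ^≡Exp^ (a * b) n | ^≡Exp^ a n | ^≡Exp^ b n = Exp.^-distrib-* a b n

  nat≡×1# : ∀ n → nat R n ≡ n × 1#
  nat≡×1# zero    = P.refl
  nat≡×1# (suc n) = P.cong (1# +_) (nat≡×1# n)

  nat-homo-+ : ∀ m n → nat R (m ℕ.+ n) ≈ nat R m + nat R n
  nat-homo-+ m n rewrite nat≡×1# (m ℕ.+ n) | nat≡×1# m | nat≡×1# n = ×-homo-+ 1# m n

  -- Opaque, so that unifying ∑ n f with ∑ n g determines f and g.
  opaque
    ∑ : ℕ → (ℕ → Carrier) → Carrier
    ∑ n f = sum {n} (λ i → f (toℕ i))

  opaque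
    unfolding ∑

    ∑-cong : ∀ n {f g : ℕ → Carrier} → (∀ i → i < n → f i ≈ g i) → ∑ n f ≈ ∑ n g
    ∑-cong n f≈g = sum-cong-≋ {n} (λ i → f≈g (toℕ i) (toℕ<n i))

    ∑-empty : ∀ (f : ℕ → Carrier) → ∑ 0 f ≈ 0#
    ∑-empty f = refl

    ∑-head : ∀ n (f : ℕ → Carrier) → ∑ (suc n) f ≈ f 0 + ∑ n (λ i → f (suc i))
    ∑-head n f = refl

    ∑-last : ∀ n (f : ℕ → Carrier) → ∑ (suc n) f ≈ ∑ n f + f n
    ∑-last n f = trans (sum-init-last {n} (λ i → f (toℕ i)))
      (+-cong (sum-cong-≋ {n} (λ i → reflexive (P.cong f (toℕ-inject₁ i))))
              (reflexive (P.cong f (toℕ-fromℕ n))))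

    ∑-zero : ∀ n {f : ℕ → Carrier} → (∀ i → i < n → f i ≈ 0#) → ∑ n f ≈ 0#
    ∑-zero n f≈0 = trans (∑-cong n f≈0) (sum-replicate-zero n)

    ∑-distrib-+ : ∀ n (f g : ℕ → Carrier) → ∑ n (λ i → f i + g i) ≈ ∑ n f + ∑ n g
    ∑-distrib-+ n f g = Sum.∑-distrib-+ {n} (λ i → f (toℕ i)) (λ i → g (toℕ i))

    *-distribˡ-∑ : ∀ n x (f : ℕ → Carrier) → x * ∑ n f ≈ ∑ n (λ i → x * f i)
    *-distribˡ-∑ n x f = Sum.*-distribˡ-sum {n} x (λ i → f (toℕ i))

    *-distribʳ-∑ : ∀ n x (f : ℕ → Carrier) → ∑ n f * x ≈ ∑ n (λ i → f i * x)
    *-distribʳ-∑ n x f = Sum.*-distribʳ-sum {n} x (λ i → f (toℕ i))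

    ∑-comm : ∀ m n (f : ℕ → ℕ → Carrier) → ∑ m (λ i → ∑ n (f i)) ≈ ∑ n (λ j → ∑ m (λ i → f i j))
    ∑-comm m n f = Sum.∑-comm {m} {n} (λ (i : Fin m) (j : Fin n) → f (toℕ i) (toℕ j))

  ∑-split : ∀ m r (f : ℕ → Carrier) → ∑ (m ℕ.+ r) f ≈ ∑ m f + ∑ r (λ i → f (m ℕ.+ i))
  ∑-split zero    r f = sym (trans (+-congʳ (∑-empty f)) (+-identityˡ _))
  ∑-split (suc m) r f = begin
    ∑ (suc m ℕ.+ r) f                                ≈⟨ ∑-head (m ℕ.+ r) f ⟩
    f 0 + ∑ (m ℕ.+ r) f[1+_]                          ≈⟨ +-congˡ (∑-split m r f[1+_]) ⟩
    f 0 + (∑ m f[1+_] + ∑ r (λ i → f (suc m ℕ.+ i))) ≈⟨ +-assoc _ _ _ ⟨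
    (f 0 + ∑ m f[1+_]) + ∑ r (λ i → f (suc m ℕ.+ i)) ≈⟨ +-congʳ (∑-head m f) ⟨
    ∑ (suc m) f + ∑ r (λ i → f (suc m ℕ.+ i))         ∎
    where
    f[1+_] : ℕ → Carrier
    f[1+_] i = f (suc i)

  ∑-split≤ : ∀ {m n} (f : ℕ → Carrier) → m ≤ n → ∑ n f ≈ ∑ m f + ∑ (n ∸ m) (λ i → f (m ℕ.+ i))
  ∑-split≤ {m} {n} f m≤n =
    trans (reflexive (P.cong (λ k → ∑ k f) (P.sym (ℕ.m+[n∸m]≡n m≤n)))) (∑-split m (n ∸ m) f)

  ∑-distrib-- : ∀ n (f g : ℕ → Carrier) → ∑ n (λ i → f i - g i) ≈ ∑ n f - ∑ n g
  ∑-distrib-- n f g = begin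
    ∑ n (λ i → f i - g i)          ≈⟨ ∑-distrib-+ n f (λ i → - g i) ⟩
    ∑ n f + ∑ n (λ i → - g i)      ≈⟨ +-congˡ (∑-cong n (λ i _ → sym (-1*x≈-x (g i)))) ⟩
    ∑ n f + ∑ n (λ i → - 1# * g i) ≈⟨ +-congˡ (sym (*-distribˡ-∑ n (- 1#) g)) ⟩
    ∑ n f + - 1# * ∑ n g           ≈⟨ +-congˡ (-1*x≈-x (∑ n g)) ⟩
    ∑ n f - ∑ n g                  ∎

  private
    suc[a+j]∸a≡suc[j] : ∀ a j → suc (a ℕ.+ j) ∸ a ≡ suc j
    suc[a+j]∸a≡suc[j] a j = P.trans (P.cong (_∸ a) (P.sym (ℕ.+-suc a j))) (ℕ.m+n∸m≡n a (suc j))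

  -- sumFromTo a b f is a loop over the count suc b ∸ a whose body does not mention b.
  sumFromTo-suc : ∀ a j (f : ℕ → Carrier) → sumFromTo R a (a ℕ.+ suc j) f ≈ f (a ℕ.+ suc j) + sumFromTo R a (a ℕ.+ j) f
  sumFromTo-suc a j f rewrite suc[a+j]∸a≡suc[j] a (suc j) | suc[a+j]∸a≡suc[j] a j = refl

  sumFromTo-+ : ∀ a j (f : ℕ → Carrier) → sumFromTo R a (a ℕ.+ j) f ≈ ∑ (suc j) (λ i → f (a ℕ.+ i))
  sumFromTo-+ a zero    f rewrite suc[a+j]∸a≡suc[j] a zero =
    sym (trans (∑-head 0 _) (+-congˡ (∑-empty _)))
  sumFromTo-+ a (suc j) f = begin
    sumFromTo R a (a ℕ.+ suc j) f               ≈⟨ sumFromTo-suc a j f ⟩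
    f (a ℕ.+ suc j) + sumFromTo R a (a ℕ.+ j) f ≈⟨ +-congˡ (sumFromTo-+ a j f) ⟩
    f (a ℕ.+ suc j) + ∑ (suc j) f[a+_]           ≈⟨ +-comm _ _ ⟩
    ∑ (suc j) f[a+_] + f (a ℕ.+ suc j)           ≈⟨ ∑-last (suc j) f[a+_] ⟨
    ∑ (suc (suc j)) f[a+_]                       ∎
    where
    f[a+_] : ℕ → Carrier
    f[a+_] i = f (a ℕ.+ i)

  sumFromTo≈∑ : ∀ {a b} (f : ℕ → Carrier) → a ≤ b → sumFromTo R a b f ≈ ∑ (suc b ∸ a) (λ i → f (a ℕ.+ i))
  sumFromTo≈∑ {a} {b} f a≤b =
    P.subst (λ b → sumFromTo R a b f ≈ ∑ (suc b ∸ a) (λ i → f (a ℕ.+ i))) (ℕ.m+[n∸m]≡n a≤b)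
      (trans (sumFromTo-+ a (b ∸ a) f)
             (reflexive (P.cong (λ k → ∑ k (λ i → f (a ℕ.+ i))) (P.sym (suc[a+j]∸a≡suc[j] a (b ∸ a))))))

  sumFromTo-empty : ∀ {a b} (f : ℕ → Carrier) → b < a → sumFromTo R a b f ≈ 0#
  sumFromTo-empty f b<a rewrite ℕ.m≤n⇒m∸n≡0 b<a = refl

  -- Polynomials in Horner form and synthetic division

  eval : ℕ → (ℕ → Carrier) → Carrier → Carrier
  eval zero    a t = 0#
  eval (suc n) a t = a 0 + t * eval n (λ i → a (suc i)) t

  eval≈∑ : ∀ n (a : ℕ → Carrier) t → eval n a t ≈ ∑ n (λ l → a l * t ^ l)
  eval≈∑ zero    a t = sym (∑-empty _)
  eval≈∑ (suc n) a t = trans (+-cong (sym (*-identityʳ (a 0))) (begin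
    t * eval n a′ t                ≈⟨ *-congˡ (eval≈∑ n a′ t) ⟩
    t * ∑ n (λ l → a′ l * t ^ l)   ≈⟨ *-distribˡ-∑ n t (λ l → a′ l * t ^ l) ⟩
    ∑ n (λ l → t * (a′ l * t ^ l)) ≈⟨ ∑-cong n (λ l _ → x∙yz≈y∙xz t (a′ l) (t ^ l)) ⟩
    ∑ n (λ l → a′ l * t ^ suc l)   ∎)) (sym (∑-head n _))
    where
    a′ : ℕ → Carrier
    a′ i = a (suc i)

  eval-zero : ∀ n (a : ℕ → Carrier) t → (∀ i → i < n → a i ≈ 0#) → eval n a t ≈ 0#
  eval-zero n a t a≈0 =
    trans (eval≈∑ n a t) (∑-zero n (λ i i<n → trans (*-congʳ (a≈0 i i<n)) (zeroˡ _)))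

  quotient : Carrier → ℕ → (ℕ → Carrier) → ℕ → Carrier
  quotient c zero    a i       = 0#
  quotient c (suc n) a zero    = eval (suc n) a c
  quotient c (suc n) a (suc i) = quotient c n (λ j → a (suc j)) i

  -- t·P(t) - c·P(c) = (t - c)·Q(t), with both sides moved so that no subtraction occurs.
  quotient-spec : ∀ c n (a : ℕ → Carrier) t →
    t * eval n a t + c * eval n (quotient c n a) t ≈ c * eval n a c + t * eval n (quotient c n a) t
  quotient-spec c zero    a t = +-comm _ _
  quotient-spec c (suc n) a t = begin
    t * (a 0 + t * P t) + c * (P₀ c + t * Q)  ≈⟨ solve 6 (λ t a₀ Pt c Pc Q →
                                                   t :* (a₀ :+ t :* Pt) :+ c :* ((a₀ :+ c :* Pc) :+ t :* Q)
                                                := t :* a₀ :+ c :* (a₀ :+ c :* Pc) :+ t :* (t :* Pt :+ c :* Q))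
                                                 refl t (a 0) (P t) c (P c) Q ⟩
    t * a 0 + c * P₀ c + t * (t * P t + c * Q) ≈⟨ +-congˡ (*-congˡ (quotient-spec c n a′ t)) ⟩
    t * a 0 + c * P₀ c + t * (c * P c + t * Q) ≈⟨ solve 6 (λ t a₀ Pc c Q Pt →
                                                   t :* a₀ :+ c :* (a₀ :+ c :* Pc) :+ t :* (c :* Pc :+ t :* Q)
                                                := c :* (a₀ :+ c :* Pc) :+ t :* ((a₀ :+ c :* Pc) :+ t :* Q))
                                                 refl t (a 0) (P c) c Q (P t) ⟩
    c * P₀ c + t * (P₀ c + t * Q)              ∎
    where
    a′ : ℕ → Carrier
    a′ i = a (suc i)
    P P₀ : Carrier → Carrier
    P  = eval n a′
    P₀ = eval (suc n) a
    Q : Carrier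
    Q = eval n (quotient c n a′) t

  module Domain (dom : IsDomain R) where

    1≉0 : 1# ≉ 0#
    1≉0 = proj₁ dom

    x≉0∧y≉0⇒x*y≉0 : ∀ {x y} → x ≉ 0# → y ≉ 0# → x * y ≉ 0#
    x≉0∧y≉0⇒x*y≉0 {x} {y} x≉0 y≉0 xy≈0 with proj₂ dom x y xy≈0
    ... | inj₁ x≈0 = x≉0 x≈0
    ... | inj₂ y≈0 = y≉0 y≈0

    x≉0⇒x*y≈0⇒y≈0 : ∀ {x y} → x ≉ 0# → x * y ≈ 0# → y ≈ 0#
    x≉0⇒x*y≈0⇒y≈0 {x} {y} x≉0 xy≈0 with proj₂ dom x y xy≈0
    ... | inj₁ x≈0 = ⊥-elim (x≉0 x≈0)
    ... | inj₂ y≈0 = y≈0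

    *-cancelˡ-nonZero : ∀ {x y z} → x ≉ 0# → x * y ≈ x * z → y ≈ z
    *-cancelˡ-nonZero {x} {y} {z} x≉0 xy≈xz =
      x∙y⁻¹≈ε⇒x≈y y z (x≉0⇒x*y≈0⇒y≈0 x≉0 (trans (x[y-z]≈xy-xz x y z) (x≈y⇒x∙y⁻¹≈ε xy≈xz)))

    x≉y⇒x*z≈y*z⇒z≈0 : ∀ {x y z} → x ≉ y → x * z ≈ y * z → z ≈ 0#
    x≉y⇒x*z≈y*z⇒z≈0 {x} {y} {z} x≉y xz≈yz
      with proj₂ dom (x - y) z (trans ([y-z]x≈yx-zx z x y) (x≈y⇒x∙y⁻¹≈ε xz≈yz))
    ... | inj₁ x-y≈0 = ⊥-elim (x≉y (x∙y⁻¹≈ε⇒x≈y x y x-y≈0))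
    ... | inj₂ z≈0   = z≈0

    ^-nonZero : ∀ {x} n → x ≉ 0# → x ^ n ≉ 0#
    ^-nonZero zero    x≉0 = 1≉0
    ^-nonZero (suc n) x≉0 = x≉0∧y≉0⇒x*y≉0 x≉0 (^-nonZero n x≉0)

  -- A polynomial vanishing at infinitely many distinct nonzero points

  module Interpolation (dom : IsDomain R) (p : ℕ → Carrier)
                       (p≉0 : ∀ x → p x ≉ 0#) (p-injective : ∀ {x y} → x < y → p y ≉ p x) where
    open Domain dom

    -- Write P(t) = a₀ + t·P′(t) and c = p N.  On the tail t·P′(t) is constant, so the quotient of
    -- t·P′(t) - c·P′(c) by t - c vanishes on the tail, hence identically (induction); thus
    -- c·P′(c) = 0, a₀ = 0, and P′ vanishes on the tail (induction again).
    eval-vanishing⇒coefficients-vanish : ∀ n (a : ℕ → Carrier) N → (∀ x → N ≤ x → eval n a (p x) ≈ 0#) →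
                                         ∀ i → i < n → a i ≈ 0#
    eval-vanishing⇒coefficients-vanish zero    a N vanish i ()
    eval-vanishing⇒coefficients-vanish (suc n) a N vanish = coefficients
      where
      a′ : ℕ → Carrier
      a′ i = a (suc i)
      c : Carrier
      c = p N
      P D : Carrier → Carrier
      P = eval n a′
      D = eval n (quotient c n a′)

      tail-constant : ∀ x → N ≤ x → p x * P (p x) ≈ c * P c
      tail-constant x N≤x = +-cancelˡ (a 0) _ _ (trans (vanish x N≤x) (sym (vanish N ℕ.≤-refl)))

      D-vanishes : ∀ x → suc N ≤ x → D (p x) ≈ 0#
      D-vanishes x N<x = x≉y⇒x*z≈y*z⇒z≈0 (p-injective N<x) (sym (+-cancelˡ (c * P c) _ _ (begin
        c * P c + c * D (p x)       ≈⟨ +-congʳ (tail-constant x (ℕ.<⇒≤ N<x)) ⟨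
        p x * P (p x) + c * D (p x) ≈⟨ quotient-spec c n a′ (p x) ⟩
        c * P c + p x * D (p x)     ∎)))

      D≈0 : ∀ t → D t ≈ 0#
      D≈0 t = eval-zero n (quotient c n a′) t
                (eval-vanishing⇒coefficients-vanish n (quotient c n a′) (suc N) D-vanishes)

      tP[t]≈cP[c] : ∀ t → t * P t ≈ c * P c
      tP[t]≈cP[c] t = begin
        t * P t             ≈⟨ +-identityʳ _ ⟨
        t * P t + 0#        ≈⟨ +-congˡ (trans (*-congˡ (D≈0 t)) (zeroʳ c)) ⟨
        t * P t + c * D t   ≈⟨ quotient-spec c n a′ t ⟩
        c * P c + t * D t   ≈⟨ +-congˡ (trans (*-congˡ (D≈0 t)) (zeroʳ t)) ⟩
        c * P c + 0#        ≈⟨ +-identityʳ _ ⟩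
        c * P c             ∎

      cP[c]≈0 : c * P c ≈ 0#
      cP[c]≈0 = trans (sym (tP[t]≈cP[c] 0#)) (zeroˡ _)

      coefficients : ∀ i → i < suc n → a i ≈ 0#
      coefficients zero    _         = begin
        a 0           ≈⟨ +-identityʳ _ ⟨
        a 0 + 0#      ≈⟨ +-congˡ cP[c]≈0 ⟨
        a 0 + c * P c ≈⟨ vanish N ℕ.≤-refl ⟩
        0#            ∎
      coefficients (suc i) (s≤s i<n) = eval-vanishing⇒coefficients-vanish n a′ N
        (λ x _ → x≉0⇒x*y≈0⇒y≈0 (p≉0 x) (trans (tP[t]≈cP[c] (p x)) cP[c]≈0)) i i<n

    coefficients-unique : ∀ n (a b : ℕ → Carrier) N →
      (∀ x → N ≤ x → ∑ n (λ l → a l * p x ^ l) ≈ ∑ n (λ l → b l * p x ^ l)) →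
      ∀ l → l < n → a l ≈ b l
    coefficients-unique n a b N agree l l<n =
      x∙y⁻¹≈ε⇒x≈y (a l) (b l) (eval-vanishing⇒coefficients-vanish n (λ l → a l - b l) N vanish l l<n)
      where
      vanish : ∀ x → N ≤ x → eval n (λ l → a l - b l) (p x) ≈ 0#
      vanish x N≤x = begin
        eval n (λ l → a l - b l) (p x)            ≈⟨ eval≈∑ n _ (p x) ⟩
        ∑ n (λ l → (a l - b l) * p x ^ l)         ≈⟨ ∑-cong n (λ l _ → [y-z]x≈yx-zx (p x ^ l) (a l) (b l)) ⟩
        ∑ n (λ l → a l * p x ^ l - b l * p x ^ l) ≈⟨ ∑-distrib-- n _ _ ⟩
        ∑ n (λ l → a l * p x ^ l) - ∑ n (λ l → b l * p x ^ l) ≈⟨ x≈y⇒x∙y⁻¹≈ε (agree x N≤x) ⟩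
        0#                                         ∎

  -- Powers of an element acting bidiagonally on a family U

  module PowerExpansion
    (z : Carrier) (U α : ℕ → Carrier) (N : ℕ)
    (z*U : ∀ k → k < N → z * U k ≈ α k * U k + U (suc k))
    (a : ℕ → ℕ → Carrier)
    (a-init   : a 0 0 * U 0 ≈ 1#)
    (a-first  : ∀ n → a (suc n) 0 ≈ α 0 * a n 0)
    (a-last   : ∀ n → a (suc n) (suc n) ≈ a n n)
    (a-pascal : ∀ n k → k < n → a (suc n) (suc k) ≈ a n k + α (suc k) * a n (suc k))
    where

    z*expansion : ∀ n → n < N →
      z * ∑ (suc n) (λ k → a n k * U k) ≈ ∑ (suc (suc n)) (λ k → a (suc n) k * U k)
    z*expansion n n<N = begin
      z * ∑ (suc n) (λ k → a n k * U k)
        ≈⟨ *-distribˡ-∑ (suc n) z (λ k → a n k * U k) ⟩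
      ∑ (suc n) (λ k → z * (a n k * U k))
        ≈⟨ ∑-cong (suc n) (λ k k≤n → shift k (ℕ.<-≤-trans k≤n n<N)) ⟩
      ∑ (suc n) (λ k → α k * a n k * U k + a n k * U (suc k))
        ≈⟨ ∑-distrib-+ (suc n) (λ k → α k * a n k * U k) (λ k → a n k * U (suc k)) ⟩
      ∑ (suc n) (λ k → α k * a n k * U k) + ∑ (suc n) (λ k → a n k * U (suc k))
        ≈⟨ +-cong (∑-head n (λ k → α k * a n k * U k)) (∑-last n (λ k → a n k * U (suc k))) ⟩
      (W + X) + (Y + Z)
        ≈⟨ solve 4 (λ W X Y Z → (W :+ X) :+ (Y :+ Z) := W :+ ((Y :+ X) :+ Z)) refl W X Y Z ⟩
      W + ((Y + X) + Z)
        ≈⟨ +-cong first (+-cong (sym pascal) (*-congʳ (sym (a-last n)))) ⟩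
      a (suc n) 0 * U 0 + (∑ n (λ k → a (suc n) (suc k) * U (suc k)) + a (suc n) (suc n) * U (suc n))
        ≈⟨ +-congˡ (∑-last n (λ k → a (suc n) (suc k) * U (suc k))) ⟨
      a (suc n) 0 * U 0 + ∑ (suc n) (λ k → a (suc n) (suc k) * U (suc k))
        ≈⟨ ∑-head (suc n) (λ k → a (suc n) k * U k) ⟨
      ∑ (suc (suc n)) (λ k → a (suc n) k * U k) ∎
      where
      W X Y Z : Carrier
      W = α 0 * a n 0 * U 0
      X = ∑ n (λ k → α (suc k) * a n (suc k) * U (suc k))
      Y = ∑ n (λ k → a n k * U (suc k))
      Z = a n n * U (suc n)

      shift : ∀ k → k < N → z * (a n k * U k) ≈ α k * a n k * U k + a n k * U (suc k)
      shift k k<N = begin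
        z * (a n k * U k)                     ≈⟨ x∙yz≈y∙xz z (a n k) (U k) ⟩
        a n k * (z * U k)                     ≈⟨ *-congˡ (z*U k k<N) ⟩
        a n k * (α k * U k + U (suc k))       ≈⟨ solve 4 (λ a α U U′ → a :* (α :* U :+ U′) := α :* a :* U :+ a :* U′)
                                                   refl (a n k) (α k) (U k) (U (suc k)) ⟩
        α k * a n k * U k + a n k * U (suc k) ∎

      first : W ≈ a (suc n) 0 * U 0
      first = *-congʳ (sym (a-first n))

      pascal : ∑ n (λ k → a (suc n) (suc k) * U (suc k)) ≈ Y + X
      pascal = begin
        ∑ n (λ k → a (suc n) (suc k) * U (suc k))
          ≈⟨ ∑-cong n (λ k k<n → trans (*-congʳ (a-pascal n k k<n)) (distribʳ _ _ _)) ⟩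
        ∑ n (λ k → a n k * U (suc k) + α (suc k) * a n (suc k) * U (suc k))
          ≈⟨ ∑-distrib-+ n (λ k → a n k * U (suc k)) (λ k → α (suc k) * a n (suc k) * U (suc k)) ⟩
        Y + X ∎

    pow-expansion : ∀ n → n ≤ N → z ^ n ≈ ∑ (suc n) (λ k → a n k * U k)
    pow-expansion zero    _   = sym (trans (∑-head 0 _) (trans (+-congˡ (∑-empty _)) (trans (+-identityʳ _) a-init)))
    pow-expansion (suc n) n<N = trans (*-congˡ (pow-expansion n (ℕ.<⇒≤ n<N))) (z*expansion n n<N)

  binomial : ∀ w n → (1# + w) ^ n ≈ ∑ (suc n) (λ k → nat R (n C k) * w ^ k)
  binomial w n = pow-expansion n ℕ.≤-refl
    where
    open PowerExpansion (1# + w) (w ^_) (λ _ → 1#) n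
      (λ k _ → solve 2 (λ w W → (con 1 :+ w) :* W := con 1 :* W :+ w :* W) refl w (w ^ k))
      (λ n k → nat R (n C k))
      (trans (*-identityʳ _) (+-identityʳ 1#))
      (λ n → sym (*-identityˡ _))
      (λ n → reflexive (P.cong (nat R) (P.trans (nCn≡1 (suc n)) (P.sym (nCn≡1 n)))))
      (λ n k _ → trans (reflexive (P.cong (nat R) (P.sym (nCk+nC[k+1]≡[n+1]C[k+1] n k))))
                       (trans (nat-homo-+ (n C k) (n C suc k)) (+-congˡ (sym (*-identityˡ _)))))

  module QNumbers (dom : IsDomain R) (q : Carrier) (q≉0 : q ≉ 0#) (nru : NotRootOfUnity R q) where
    open Domain dom

    δ : Carrier
    δ = q - 1#

    [_]q : ℕ → Carrier
    [_]q = qnum R q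

    [_]q! : ℕ → Carrier
    [_]q! = qfact R q

    q≈1+δ : q ≈ 1# + δ
    q≈1+δ = begin
      q                ≈⟨ +-identityʳ q ⟨
      q + 0#           ≈⟨ +-congˡ (-‿inverseˡ 1#) ⟨
      q + (- 1# + 1#)  ≈⟨ +-assoc q (- 1#) 1# ⟨
      δ + 1#           ≈⟨ +-comm δ 1# ⟩
      1# + δ           ∎

    [+]q : ∀ a b → [ a ℕ.+ b ]q ≈ [ a ]q + q ^ a * [ b ]q
    [+]q zero    b = sym (trans (+-identityˡ _) (*-identityˡ _))
    [+]q (suc a) b = trans (+-congˡ (*-congˡ ([+]q a b)))
      (solve 4 (λ q A Q B → con 1 :+ q :* (A :+ Q :* B) := (con 1 :+ q :* A) :+ (q :* Q) :* B)
             refl q [ a ]q (q ^ a) [ b ]q)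

    q^≈1+δ[]q : ∀ x → q ^ x ≈ 1# + δ * [ x ]q
    q^≈1+δ[]q zero    = sym (trans (+-congˡ (zeroʳ δ)) (+-identityʳ 1#))
    q^≈1+δ[]q (suc x) = begin
      q * q ^ x                         ≈⟨ *-cong q≈1+δ (q^≈1+δ[]q x) ⟩
      (1# + δ) * (1# + δ * [ x ]q)      ≈⟨ solve 2 (λ δ X → (con 1 :+ δ) :* (con 1 :+ δ :* X)
                                                         := con 1 :+ δ :* (con 1 :+ (con 1 :+ δ) :* X)) refl δ [ x ]q ⟩
      1# + δ * (1# + (1# + δ) * [ x ]q) ≈⟨ +-congˡ (*-congˡ (+-congˡ (*-congʳ q≈1+δ))) ⟨
      1# + δ * [ suc x ]q               ∎

    δ≉0 : δ ≉ 0#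
    δ≉0 δ≈0 = nru 0 (begin
      q * 1#  ≈⟨ *-identityʳ q ⟩
      q       ≈⟨ q≈1+δ ⟩
      1# + δ  ≈⟨ +-congˡ δ≈0 ⟩
      1# + 0# ≈⟨ +-identityʳ 1# ⟩
      1#      ∎)

    [suc]q≉0 : ∀ j → [ suc j ]q ≉ 0#
    [suc]q≉0 j [1+j]≈0 = nru j (begin
      q ^ suc j              ≈⟨ q^≈1+δ[]q (suc j) ⟩
      1# + δ * [ suc j ]q    ≈⟨ +-congˡ (trans (*-congˡ [1+j]≈0) (zeroʳ δ)) ⟩
      1# + 0#                ≈⟨ +-identityʳ 1# ⟩
      1#                     ∎)

    []q-injective : ∀ {k x} → k < x → [ x ]q ≉ [ k ]q
    []q-injective {k} {x} k<x [x]≈[k] = x≉0∧y≉0⇒x*y≉0 (^-nonZero k q≉0) ([suc]q≉0 d)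
      (+-cancelˡ [ k ]q _ _ (begin
        [ k ]q + q ^ k * [ suc d ]q ≈⟨ [+]q k (suc d) ⟨
        [ k ℕ.+ suc d ]q            ≈⟨ reflexive (P.cong [_]q k+[1+d]≡x) ⟩
        [ x ]q                      ≈⟨ [x]≈[k] ⟩
        [ k ]q                      ≈⟨ +-identityʳ _ ⟨
        [ k ]q + 0#                 ∎))
      where
      d : ℕ
      d = x ∸ suc k
      k+[1+d]≡x : k ℕ.+ suc d ≡ x
      k+[1+d]≡x = P.trans (ℕ.+-suc k d) (ℕ.m+[n∸m]≡n k<x)

    [_]q!≉0 : ∀ n → [ n ]q! ≉ 0#
    [ zero  ]q!≉0 = 1≉0
    [ suc n ]q!≉0 = x≉0∧y≉0⇒x*y≉0 ([suc]q≉0 n) [ n ]q!≉0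

  -- Gaussian binomial coefficients and the q-binomial theorem

  module GaussBinomial (dom : IsDomain R) (q : Carrier) (q≉0 : q ≉ 0#) (nru : NotRootOfUnity R q)
                       (G : ℕ → ℕ → Carrier) (isGauss : IsGaussBinom R q G) where
    open Domain dom
    open QNumbers dom q q≉0 nru

    gauss : ∀ {n k d} → k ≤ n → n ∸ k ≡ d → ([ k ]q! * [ d ]q!) * G n k ≈ [ n ]q!
    gauss {n} {k} k≤n P.refl = isGauss n k k≤n

    G-zero : ∀ n → G n 0 ≈ 1#
    G-zero n = *-cancelˡ-nonZero [ n ]q!≉0 (begin
      [ n ]q! * G n 0         ≈⟨ *-congʳ (*-identityˡ _) ⟨
      (1# * [ n ]q!) * G n 0  ≈⟨ isGauss n 0 z≤n ⟩
      [ n ]q!                 ≈⟨ *-identityʳ _ ⟨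
      [ n ]q! * 1#            ∎)

    G-diag : ∀ n → G n n ≈ 1#
    G-diag n = *-cancelˡ-nonZero [ n ]q!≉0 (begin
      [ n ]q! * G n n         ≈⟨ *-congʳ (*-identityʳ _) ⟨
      ([ n ]q! * 1#) * G n n  ≈⟨ gauss ℕ.≤-refl (ℕ.n∸n≡0 n) ⟩
      [ n ]q!                 ≈⟨ *-identityʳ _ ⟨
      [ n ]q! * 1#            ∎)

    G-pascal-+ : ∀ k d → let n = k ℕ.+ suc d in
                 G (suc n) (suc k) ≈ G n k + q ^ suc k * G n (suc k)
    G-pascal-+ k d = *-cancelˡ-nonZero (x≉0∧y≉0⇒x*y≉0 [ suc k ]q!≉0 [ suc d ]q!≉0) (begin
      ([ suc k ]q! * [ suc d ]q!) * G (suc n) (suc k)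
        ≈⟨ gauss (s≤s (ℕ.m≤m+n k (suc d))) (ℕ.m+n∸m≡n k (suc d)) ⟩
      [ suc n ]q * [ n ]q!
        ≈⟨ *-congʳ ([+]q (suc k) (suc d)) ⟩
      ([ suc k ]q + q ^ suc k * [ suc d ]q) * [ n ]q!
        ≈⟨ distribʳ _ _ _ ⟩
      [ suc k ]q * [ n ]q! + (q ^ suc k * [ suc d ]q) * [ n ]q!
        ≈⟨ +-cong (*-congˡ (sym [k]![1+d]!G)) (*-congˡ (sym [1+k]![d]!G)) ⟩
      [ suc k ]q * (([ k ]q! * [ suc d ]q!) * G n k)
        + (q ^ suc k * [ suc d ]q) * (([ suc k ]q! * [ d ]q!) * G n (suc k))
        ≈⟨ solve 7 (λ Q₁ F₁ Q₂ F₂ A p B →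
              Q₁ :* ((F₁ :* (Q₂ :* F₂)) :* A) :+ (p :* Q₂) :* (((Q₁ :* F₁) :* F₂) :* B)
           := ((Q₁ :* F₁) :* (Q₂ :* F₂)) :* (A :+ p :* B))
           refl [ suc k ]q [ k ]q! [ suc d ]q [ d ]q! (G n k) (q ^ suc k) (G n (suc k)) ⟩
      ([ suc k ]q! * [ suc d ]q!) * (G n k + q ^ suc k * G n (suc k)) ∎)
      where
      n : ℕ
      n = k ℕ.+ suc d
      [k]![1+d]!G : ([ k ]q! * [ suc d ]q!) * G n k ≈ [ n ]q!
      [k]![1+d]!G = gauss (ℕ.m≤m+n k (suc d)) (ℕ.m+n∸m≡n k (suc d))
      [1+k]![d]!G : ([ suc k ]q! * [ d ]q!) * G n (suc k) ≈ [ n ]q!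
      [1+k]![d]!G = gauss (P.subst (suc k ≤_) (P.sym (ℕ.+-suc k d)) (s≤s (ℕ.m≤m+n k d)))
                          (P.trans (P.cong (_∸ suc k) (ℕ.+-suc k d)) (ℕ.m+n∸m≡n k d))

    G-pascal : ∀ n k → k < n → G (suc n) (suc k) ≈ G n k + q ^ suc k * G n (suc k)
    G-pascal n k k<n = P.subst (λ n → G (suc n) (suc k) ≈ G n k + q ^ suc k * G n (suc k))
      (P.trans (ℕ.+-suc k (n ∸ suc k)) (ℕ.m+[n∸m]≡n k<n)) (G-pascal-+ k (n ∸ suc k))

    basis : ℕ → ℕ → Carrier
    basis x k = δ ^ k * (q ^ (k C 2) * qfall R q x k)

    q^*basis : ∀ x k → k < x → q ^ x * basis x k ≈ q ^ k * basis x k + basis x (suc k)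
    q^*basis x k k<x = begin
      q ^ x * basis x k
        ≈⟨ *-congʳ q^x≈ ⟩
      (q ^ k + δ * (q ^ k * [ x ∸ k ]q)) * (δ ^ k * (q ^ (k C 2) * qfall R q x k))
        ≈⟨ solve 6 (λ Q δ X D C F → (Q :+ δ :* (Q :* X)) :* (D :* (C :* F))
                                  := Q :* (D :* (C :* F)) :+ (δ :* D) :* ((C :* Q) :* (F :* X)))
                   refl (q ^ k) δ [ x ∸ k ]q (δ ^ k) (q ^ (k C 2)) (qfall R q x k) ⟩
      q ^ k * basis x k + δ ^ suc k * ((q ^ (k C 2) * q ^ k) * qfall R q x (suc k))
        ≈⟨ +-congˡ (*-congˡ (*-congʳ (sym q^[1+k]C2))) ⟩
      q ^ k * basis x k + basis x (suc k) ∎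
      where
      q^[1+k]C2 : q ^ (suc k C 2) ≈ q ^ (k C 2) * q ^ k
      q^[1+k]C2 = trans (reflexive (P.cong (q ^_) (P.trans
                    (P.sym (nCk+nC[k+1]≡[n+1]C[k+1] k 1))
                    (P.trans (P.cong (ℕ._+ (k C 2)) (nC1≡n k)) (ℕ.+-comm k (k C 2))))))
                  (^-homo-* q (k C 2) k)
      q^x≈ : q ^ x ≈ q ^ k + δ * (q ^ k * [ x ∸ k ]q)
      q^x≈ = begin
        q ^ x                                      ≈⟨ q^≈1+δ[]q x ⟩
        1# + δ * [ x ]q                            ≈⟨ +-congˡ (*-congˡ (reflexive (P.cong [_]q (P.sym (ℕ.m+[n∸m]≡n (ℕ.<⇒≤ k<x)))))) ⟩
        1# + δ * [ k ℕ.+ (x ∸ k) ]q                ≈⟨ +-congˡ (*-congˡ ([+]q k (x ∸ k))) ⟩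
        1# + δ * ([ k ]q + q ^ k * [ x ∸ k ]q)     ≈⟨ solve 4 (λ δ A Q X → con 1 :+ δ :* (A :+ Q :* X)
                                                                    := (con 1 :+ δ :* A) :+ δ :* (Q :* X))
                                                                 refl δ [ k ]q (q ^ k) [ x ∸ k ]q ⟩
        (1# + δ * [ k ]q) + δ * (q ^ k * [ x ∸ k ]q) ≈⟨ +-congʳ (q^≈1+δ[]q k) ⟨
        q ^ k + δ * (q ^ k * [ x ∸ k ]q)           ∎

    q-binomial : ∀ x n → n ≤ x → (q ^ x) ^ n ≈ ∑ (suc n) (λ k → G n k * basis x k)
    q-binomial x n n≤x = pow-expansion n n≤x
      where
      open PowerExpansion (q ^ x) (basis x) (q ^_) x (q^*basis x) G
        (trans (*-cong (G-zero 0) (trans (*-identityˡ _) (*-identityʳ _))) (*-identityˡ 1#))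
        (λ n → trans (G-zero (suc n)) (sym (trans (*-identityˡ _) (G-zero n))))
        (λ n → trans (G-diag (suc n)) (sym (G-diag n)))
        G-pascal

  -- Comparing the binomial and the q-Stirling expansion of (q^x)^n

  module StirlingExpansion (dom : IsDomain R) (q : Carrier) (q≉0 : q ≉ 0#) (nru : NotRootOfUnity R q)
                           (G s : ℕ → ℕ → Carrier)
                           (isGauss : IsGaussBinom R q G) (isStirling : IsQStirling1 R q s) where
    open Domain dom
    open QNumbers dom q q≉0 nru
    open GaussBinomial dom q q≉0 nru G isGauss

    -- IsQStirling1 constrains s k l only for l ≤ k.
    s₀ : ℕ → ℕ → Carrier
    s₀ k l with l ℕ.≤? k
    ... | yes _ = s k l
    ... | no  _ = 0#

    s₀≈s : ∀ {k l} → l ≤ k → s₀ k l ≈ s k l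
    s₀≈s {k} {l} l≤k with l ℕ.≤? k
    ... | yes _   = refl
    ... | no  l≰k = ⊥-elim (l≰k l≤k)

    s₀≈0 : ∀ {k l} → k < l → s₀ k l ≈ 0#
    s₀≈0 {k} {l} k<l with l ℕ.≤? k
    ... | yes l≤k = ⊥-elim (ℕ.<⇒≱ k<l l≤k)
    ... | no  _   = refl

    stirling : ∀ {n x k} → k ≤ n → k ≤ x →
               q ^ (k C 2) * qfall R q x k ≈ ∑ (suc n) (λ l → s₀ k l * [ x ]q ^ l)
    stirling {n} {x} {k} k≤n k≤x = begin
      q ^ (k C 2) * qfall R q x k           ≈⟨ isStirling k x k≤x ⟩
      sumTo R k (λ l → s k l * [ x ]q ^ l)  ≈⟨ sumFromTo≈∑ _ z≤n ⟩
      ∑ (suc k) (λ l → s k l * [ x ]q ^ l)  ≈⟨ ∑-cong (suc k) (λ l l≤k → *-congʳ (sym (s₀≈s (ℕ.≤-pred l≤k)))) ⟩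
      ∑ (suc k) t                           ≈⟨ +-identityʳ _ ⟨
      ∑ (suc k) t + 0#                      ≈⟨ +-congˡ (∑-zero (suc n ∸ suc k) (λ i _ →
                                                 trans (*-congʳ (s₀≈0 (ℕ.m≤m+n (suc k) i))) (zeroˡ _))) ⟨
      ∑ (suc k) t + ∑ (suc n ∸ suc k) (λ i → t (suc k ℕ.+ i)) ≈⟨ ∑-split≤ t (s≤s k≤n) ⟨
      ∑ (suc n) t                           ∎
      where
      t : ℕ → Carrier
      t l = s₀ k l * [ x ]q ^ l

    q-Stirling-expansion : ∀ x n → n ≤ x →
      (q ^ x) ^ n ≈ ∑ (suc n) (λ l → ∑ (suc n) (λ k → G n k * δ ^ k * s₀ k l) * [ x ]q ^ l)
    q-Stirling-expansion x n n≤x = begin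
      (q ^ x) ^ n
        ≈⟨ q-binomial x n n≤x ⟩
      ∑ (suc n) (λ k → G n k * basis x k)
        ≈⟨ ∑-cong (suc n) (λ k k≤n → expand k (ℕ.≤-pred k≤n)) ⟩
      ∑ (suc n) (λ k → ∑ (suc n) (λ l → G n k * δ ^ k * s₀ k l * [ x ]q ^ l))
        ≈⟨ ∑-comm (suc n) (suc n) (λ k l → G n k * δ ^ k * s₀ k l * [ x ]q ^ l) ⟩
      ∑ (suc n) (λ l → ∑ (suc n) (λ k → G n k * δ ^ k * s₀ k l * [ x ]q ^ l))
        ≈⟨ ∑-cong (suc n) (λ l _ → *-distribʳ-∑ (suc n) ([ x ]q ^ l) (λ k → G n k * δ ^ k * s₀ k l)) ⟨
      ∑ (suc n) (λ l → ∑ (suc n) (λ k → G n k * δ ^ k * s₀ k l) * [ x ]q ^ l) ∎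
      where
      expand : ∀ k → k ≤ n → G n k * basis x k ≈ ∑ (suc n) (λ l → G n k * δ ^ k * s₀ k l * [ x ]q ^ l)
      expand k k≤n = begin
        G n k * (δ ^ k * (q ^ (k C 2) * qfall R q x k))
          ≈⟨ *-congˡ (*-congˡ (stirling k≤n (ℕ.≤-trans k≤n n≤x))) ⟩
        G n k * (δ ^ k * ∑ (suc n) (λ l → s₀ k l * [ x ]q ^ l))
          ≈⟨ *-assoc _ _ _ ⟨
        G n k * δ ^ k * ∑ (suc n) (λ l → s₀ k l * [ x ]q ^ l)
          ≈⟨ *-distribˡ-∑ (suc n) (G n k * δ ^ k) (λ l → s₀ k l * [ x ]q ^ l) ⟩
        ∑ (suc n) (λ l → G n k * δ ^ k * (s₀ k l * [ x ]q ^ l))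
          ≈⟨ ∑-cong (suc n) (λ l _ → sym (*-assoc _ _ _)) ⟩
        ∑ (suc n) (λ l → G n k * δ ^ k * s₀ k l * [ x ]q ^ l) ∎

    binomial-expansion : ∀ x n → (q ^ x) ^ n ≈ ∑ (suc n) (λ l → nat R (n C l) * δ ^ l * [ x ]q ^ l)
    binomial-expansion x n = begin
      (q ^ x) ^ n                                            ≈⟨ ^-congˡ n (q^≈1+δ[]q x) ⟩
      (1# + δ * [ x ]q) ^ n                                  ≈⟨ binomial (δ * [ x ]q) n ⟩
      ∑ (suc n) (λ l → nat R (n C l) * (δ * [ x ]q) ^ l)    ≈⟨ ∑-cong (suc n) (λ l _ →
                                                                  trans (*-congˡ (^-distrib-* δ [ x ]q l)) (sym (*-assoc _ _ _))) ⟩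
      ∑ (suc n) (λ l → nat R (n C l) * δ ^ l * [ x ]q ^ l)  ∎

    coefficients-agree : ∀ {n l} → l ≤ n → nat R (n C l) * δ ^ l ≈ ∑ (suc n) (λ k → G n k * δ ^ k * s₀ k l)
    coefficients-agree {n} {l} l≤n =
      coefficients-unique (suc n) (λ l → nat R (n C l) * δ ^ l) (λ l → ∑ (suc n) (λ k → G n k * δ ^ k * s₀ k l))
        n agree l (s≤s l≤n)
      where
      open Interpolation dom (λ x → [ suc x ]q) [suc]q≉0 (λ x<y → []q-injective (s≤s x<y))
      agree : ∀ x → n ≤ x → ∑ (suc n) (λ l → nat R (n C l) * δ ^ l * [ suc x ]q ^ l)
                           ≈ ∑ (suc n) (λ l → ∑ (suc n) (λ k → G n k * δ ^ k * s₀ k l) * [ suc x ]q ^ l)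
      agree x n≤x = trans (sym (binomial-expansion (suc x) n)) (q-Stirling-expansion (suc x) n (ℕ.m≤n⇒m≤1+n n≤x))

    binomial≈q-Stirling-sum : ∀ {n m} → m ≤ n →
      nat R (n C m) ≈ sumFromTo R m n (λ k → δ ^ (k ∸ m) * G n k * s k m)
    binomial≈q-Stirling-sum {n} {m} m≤n = *-cancelˡ-nonZero (^-nonZero m δ≉0) (begin
      δ ^ m * nat R (n C m)                       ≈⟨ *-comm _ _ ⟩
      nat R (n C m) * δ ^ m                       ≈⟨ coefficients-agree m≤n ⟩
      ∑ (suc n) H                                 ≈⟨ ∑-split≤ H (ℕ.m≤n⇒m≤1+n m≤n) ⟩
      ∑ m H + ∑ (suc n ∸ m) (λ i → H (m ℕ.+ i))   ≈⟨ +-congʳ (∑-zero m (λ k k<m → trans (*-congˡ (s₀≈0 k<m)) (zeroʳ _))) ⟩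
      0# + ∑ (suc n ∸ m) (λ i → H (m ℕ.+ i))      ≈⟨ +-identityˡ _ ⟩
      ∑ (suc n ∸ m) (λ i → H (m ℕ.+ i))           ≈⟨ ∑-cong (suc n ∸ m) (λ i _ → H[m+i]) ⟩
      ∑ (suc n ∸ m) (λ i → δ ^ m * F (m ℕ.+ i))   ≈⟨ *-distribˡ-∑ (suc n ∸ m) (δ ^ m) (λ i → F (m ℕ.+ i)) ⟨
      δ ^ m * ∑ (suc n ∸ m) (λ i → F (m ℕ.+ i))   ≈⟨ *-congˡ (sumFromTo≈∑ F m≤n) ⟨
      δ ^ m * sumFromTo R m n F                   ∎)
      where
      F H : ℕ → Carrier
      F k = δ ^ (k ∸ m) * G n k * s k m
      H k = G n k * δ ^ k * s₀ k m
      H[m+i] : ∀ {i} → H (m ℕ.+ i) ≈ δ ^ m * F (m ℕ.+ i)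
      H[m+i] {i} = begin
        G n (m ℕ.+ i) * δ ^ (m ℕ.+ i) * s₀ (m ℕ.+ i) m
          ≈⟨ *-cong (*-congˡ (^-homo-* δ m i)) (s₀≈s (ℕ.m≤m+n m i)) ⟩
        G n (m ℕ.+ i) * (δ ^ m * δ ^ i) * s (m ℕ.+ i) m
          ≈⟨ solve 4 (λ g a b t → g :* (a :* b) :* t := a :* (b :* g :* t)) refl (G n (m ℕ.+ i)) (δ ^ m) (δ ^ i) (s (m ℕ.+ i) m) ⟩
        δ ^ m * (δ ^ i * G n (m ℕ.+ i) * s (m ℕ.+ i) m)
          ≈⟨ *-congˡ (*-congʳ (*-congʳ (reflexive (P.cong (δ ^_) (P.sym (ℕ.m+n∸m≡n m i)))))) ⟩
        δ ^ m * F (m ℕ.+ i) ∎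

theorem5 : ∀ {c ℓ : Level} (R : CommutativeRing c ℓ) → IsDomain R →
    (q : CommutativeRing.Carrier R) →
    ¬ (CommutativeRing._≈_ R q (CommutativeRing.0# R)) →
    NotRootOfUnity R q →
    (G s : ℕ → ℕ → CommutativeRing.Carrier R) →
    IsGaussBinom R q G → IsQStirling1 R q s →
    (n m : ℕ) →
    CommutativeRing._≈_ R (nat R (n C m))
      (sumFromTo R m n (λ k → CommutativeRing._*_ R
        (CommutativeRing._*_ R
          (pow R (CommutativeRing._-_ R q (CommutativeRing.1# R)) (k ∸ m))
          (G n k))
        (s k m)))
theorem5 R dom q q≉0 nru G s isGauss isStirling n m with m ℕ.≤? n
... | yes m≤n = StirlingExpansion.binomial≈q-Stirling-sum R dom q q≉0 nru G s isGauss isStirling m≤n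
... | no  m≰n = trans (reflexive (P.cong (nat R) (k>n⇒nCk≡0 (ℕ.≰⇒> m≰n))))
                      (sym (sumFromTo-empty R _ (ℕ.≰⇒> m≰n)))
  where open CommutativeRing R using (trans; sym; reflexive)
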